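{- Let $n\ge 0$ and let $\sigma\in I(321)_{2n+2}$ be a simple involution, written $\sigma=(m_1,M_1)\cdots(m_{n+1},M_{n+1})$ with $m_i<M_i$, $m_1<\cdots<m_{n+1}$, $M_1<\cdots<M_{n+1}$, and let $(s_1,\dots,s_{n+1})$ be its associated sequence. Then: (i) each $s_i$ is odd; (ii) $s_1=s_{n+1}=1$; (iii) if $s_i=1$ then $s_{i-1}\neq 1$ and $s_{i+1}\ne 1$ (whenever these indices lie in $\{1,\dots,n+1\}$); (iv) $|s_{i+1}-s_i|\le 2$ for $i=1,\dots,n$.
   Context: A permutation of length $N$ is a bijection of $\{1,\dots,N\}$. A permutation avoids $321$ if it has no indices $i<j<k$ with $\pi(i)>\pi(j)>\pi(k)$. An involution satisfies $\pi(\pi(i))=i$ for all $i$; $I(321)_N$ is the set of involutions of length $N$ avoiding $321$. An interval of a permutation of length $N$ is a set of contiguous positions whose image is a set of contiguous integers; a permutation is simple if its only intervals are the empty set, singletons and $[1,N]$. A simple involution in $I(321)$ of even length has no fixed points. The associated sequence of such $\sigma$ is defined by letting $s_i$ be the number of times the plot of $\sigma$ (the polygonal line joining $(1,\sigma(1)),\dots,(N,\sigma(N))$ in order) crosses the line $y=x$ between the maximum point $(m_i,M_i)$ and the minimum point $(M_i,m_i)$; equivalently, $s_i$ is the number of indices $j$ with $m_i\le j<M_i$ such that $\sigma(j)-j$ and $\sigma(j+1)-(j+1)$ have opposite signs. -}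

module Defs where

open import Data.Nat as ℕ using (ℕ; zero; suc; _+_; _∸_; _<ᵇ_; _<?_)
open import Data.Bool using (Bool; true; false; _∧_; _∨_; if_then_else_)
open import Data.Fin as Fin using (Fin; toℕ; fromℕ<)
open import Data.Fin.Permutation using (Permutation′; _⟨$⟩ʳ_)
open import Data.Product using (_×_; ∃)
open import Data.Sum using (_⊎_)
open import Relation.Nullary using (¬_; yes; no)
open import Relation.Binary.PropositionalEquality using (_≡_)

-- Permutations of length N act on positions/values Fin N = {0,…,N-1}
-- (0-indexed version of {1,…,N}).

IsInvolution : ∀ {N} → Permutation′ N → Set
IsInvolution σ = ∀ i → σ ⟨$⟩ʳ (σ ⟨$⟩ʳ i) ≡ i

Avoids321 : ∀ {N} → Permutation′ N → Set
Avoids321 σ = ∀ i j k → i Fin.< j → j Fin.< k →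
  ¬ ((σ ⟨$⟩ʳ j) Fin.< (σ ⟨$⟩ʳ i) × (σ ⟨$⟩ʳ k) Fin.< (σ ⟨$⟩ʳ j))

-- The (nonempty) set of contiguous positions [a,b] is an interval of σ:
-- its image is a set of contiguous integers.
IsInterval : ∀ {N} → Permutation′ N → Fin N → Fin N → Set
IsInterval {N} σ a b =
  ∀ (i j : Fin N) (v : Fin N) →
    a Fin.≤ i → i Fin.≤ b → a Fin.≤ j → j Fin.≤ b →
    (σ ⟨$⟩ʳ i) Fin.≤ v → v Fin.≤ (σ ⟨$⟩ʳ j) →
    ∃ λ k → a Fin.≤ k × k Fin.≤ b × σ ⟨$⟩ʳ k ≡ v

-- σ is simple: every interval is empty, a singleton, or all of [0,N-1].
-- (Sets of contiguous positions are ∅ or [a,b] with a ≤ b; ∅ is always allowed.)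
IsSimple : ∀ {N} → Permutation′ N → Set
IsSimple {N} σ = ∀ (a b : Fin N) → a Fin.≤ b → IsInterval σ a b →
  a ≡ b ⊎ (toℕ a ≡ 0 × suc (toℕ b) ≡ N)

-- value of σ at a natural-number position (0 outside the range; unused there)
val : ∀ {N} → Permutation′ N → ℕ → ℕ
val {N} σ j with j <? N
... | yes p = toℕ (σ ⟨$⟩ʳ fromℕ< p)
... | no _ = 0

crossesAt : ∀ {N} → Permutation′ N → ℕ → Bool
crossesAt σ j =
  ((j <ᵇ val σ j) ∧ (val σ (suc j) <ᵇ suc j)) ∨
  ((val σ j <ᵇ j) ∧ (suc j <ᵇ val σ (suc j)))

countRange : (ℕ → Bool) → ℕ → ℕ → ℕ
countRange f a zero = 0
countRange f a (suc k) = (if f a then 1 else 0) + countRange f (suc a) k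

-- s = #{ j : m ≤ j < M, plot crosses y = x between j and j+1 }
crossings : ∀ {N} → Permutation′ N → Fin N → Fin N → ℕ
crossings σ m M = countRange (crossesAt σ) (toℕ m) (toℕ M ∸ toℕ m)

module Submission where

-- Let w(j) say that j is an excedance of σ (j < σ(j)).  Every
-- position is some m_k (w true) or some M_k (w false), so σ has no fixed point
-- and the plot crosses y = x between j and j+1 exactly when w changes there:
-- s_k counts the changes of the Boolean word w on [m_k, M_k).  As w(m_k) ≠ w(M_k),
-- s_k is odd (i); only m's lie before M_1 and only M's after m_{n+1} (ii).  For
-- consecutive pairs i, j = i+1 simplicity gives m_j < M_i (else [0, M_i] is an
-- interval), so s_i = A + X and s_j = X + B for the counts on [m_i, m_j),
-- [m_j, M_i), [M_i, M_j).  Only M's lie between m_i and m_j and only m's between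
-- M_i and M_j, so A, B ≤ 2 (iv); A = B = 0 would make {m_i, m_j} an interval (iii).

open import Defs
open import Data.Nat using (ℕ; suc; _+_; _≤_; _%_)
open import Data.Fin as Fin using (Fin; toℕ; fromℕ)
open import Data.Fin.Permutation using (Permutation′; _⟨$⟩ʳ_)
open import Data.Product using (_×_)
open import Data.Sum using (_⊎_)
open import Relation.Binary.PropositionalEquality using (_≡_; _≢_)

open import Data.Nat
  using (zero; _∸_; _<_; _<ᵇ_; _<?_; z≤n; s≤s; s≤s⁻¹; z<s; _≤′_; ≤′-refl; ≤′-step)
open import Data.Nat.Properties
open import Data.Nat.DivMod using (%-distribˡ-+)
open import Data.Bool using (Bool; true; false; not; _∧_; _∨_; _xor_; if_then_else_)
open import Data.Bool.Properties using (xor-same)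
open import Data.Fin using (fromℕ<; splitAt)
open import Data.Fin.Properties
  using (toℕ-injective; toℕ<n; toℕ-fromℕ; toℕ-fromℕ<; fromℕ<-toℕ; any?;
         injective⇒≤; join-splitAt; punchOut-injective)
  renaming (_≟_ to _≟ᶠ_)
open import Data.Product using (∃; _,_; proj₁; proj₂)
open import Data.Sum using (inj₁; inj₂; [_,_]′)
open import Data.Empty using (⊥; ⊥-elim)
open import Relation.Nullary using (yes; no; contradiction)
open import Relation.Binary using (tri<; tri≈; tri>)
open import Relation.Binary.PropositionalEquality
  using (refl; sym; trans; cong; cong₂; subst; module ≡-Reasoning)
open import Function.Definitions using (Injective)

count : Bool → ℕ
count b = if b then 1 else 0

count≤1 : ∀ b → count b ≤ 1
count≤1 true  = ≤-refl
count≤1 false = z≤n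

xor-not : ∀ x → not x xor x ≡ true
xor-not true  = refl
xor-not false = refl

xor-parity : ∀ x y z → (count (x xor y) + count (y xor z) % 2) % 2 ≡ count (x xor z)
xor-parity true  true  true  = refl
xor-parity true  true  false = refl
xor-parity true  false true  = refl
xor-parity true  false false = refl
xor-parity false true  true  = refl
xor-parity false true  false = refl
xor-parity false false true  = refl
xor-parity false false false = refl

-- The crossing test of Defs, in terms of excedance bits x, y of two
-- positions without fixed points, is "the bits differ".
sign-change : ∀ x y → (x ∧ not y) ∨ (not x ∧ y) ≡ x xor y
sign-change true  true  = refl
sign-change true  false = refl
sign-change false true  = refl
sign-change false false = refl

<ᵇ-true : ∀ {p q} → p < q → (p <ᵇ q) ≡ true
<ᵇ-true {zero}  (s≤s _)  = refl
<ᵇ-true {suc p} (s≤s lt) = <ᵇ-true lt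

<ᵇ-false : ∀ {p q} → q ≤ p → (p <ᵇ q) ≡ false
<ᵇ-false {q = zero} _          = refl
<ᵇ-false            (s≤s q≤p) = <ᵇ-false q≤p

odd-summand : ∀ a x → x % 2 ≡ 1 → a + x ≡ 1 → a ≡ 0
odd-summand a (suc x) _ sum = m+n≡0⇒m≡0 a (suc-injective (trans (sym (+-suc a x)) sum))

neighbour-sums : ∀ {a b} x → a ≤ 2 → b ≤ 2 → x + b ≤ a + x + 2 × a + x ≤ x + b + 2
neighbour-sums {a} {b} x a≤2 b≤2 =
    ≤-trans (+-monoʳ-≤ x b≤2) (+-monoˡ-≤ 2 (m≤n+m x a))
  , ≤-trans (+-monoˡ-≤ x a≤2) (≤-trans (≤-reflexive (+-comm 2 x)) (+-monoˡ-≤ 2 (m≤m+n x b)))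

countRange-++ : ∀ f a k l →
  countRange f a (k + l) ≡ countRange f a k + countRange f (a + k) l
countRange-++ f a zero    l = cong (λ x → countRange f x l) (sym (+-identityʳ a))
countRange-++ f a (suc k) l rewrite countRange-++ f (suc a) k l | +-suc a k =
  sym (+-assoc (count (f a)) _ _)

countRange-cong : ∀ f g a k → (∀ j → j < a + k → f j ≡ g j) →
  countRange f a k ≡ countRange g a k
countRange-cong f g a zero    _  = refl
countRange-cong f g a (suc k) eq =
  cong₂ _+_ (cong count (eq a (m<m+n a z<s)))
            (countRange-cong f g (suc a) k (λ j lt → eq j (subst (j <_) (sym (+-suc a k)) lt)))

module Changes (w : ℕ → Bool) where

  changes : ℕ → Bool
  changes j = w j xor w (suc j)

  flips : ℕ → ℕ → ℕ
  flips a b = countRange changes a (b ∸ a)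

  flips-refl : ∀ a → flips a a ≡ 0
  flips-refl a rewrite n∸n≡0 a = refl

  flips-split : ∀ {a b c} → a ≤ b → b ≤ c → flips a c ≡ flips a b + flips b c
  flips-split {a} {b} {c} a≤b b≤c = begin
      countRange changes a (c ∸ a)
    ≡⟨ cong (countRange changes a) lengths ⟩
      countRange changes a ((b ∸ a) + (c ∸ b))
    ≡⟨ countRange-++ changes a (b ∸ a) (c ∸ b) ⟩
      flips a b + countRange changes (a + (b ∸ a)) (c ∸ b)
    ≡⟨ cong (λ x → flips a b + countRange changes x (c ∸ b)) (m+[n∸m]≡n a≤b) ⟩
      flips a b + flips b c
    ∎
    where
      open ≡-Reasoning
      lengths : c ∸ a ≡ (b ∸ a) + (c ∸ b)
      lengths = trans (cong (_∸ a) (sym (m∸n+n≡m b≤c)))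
                      (trans (+-∸-assoc (c ∸ b) a≤b) (+-comm (c ∸ b) (b ∸ a)))

  flips-step : ∀ a → flips a (suc a) ≡ count (changes a)
  flips-step a rewrite m+n∸n≡m 1 a = +-identityʳ (count (changes a))

  flips-snoc : ∀ {a b} → a ≤ b → flips a (suc b) ≡ flips a b + count (changes b)
  flips-snoc {a} {b} a≤b = trans (flips-split a≤b (n≤1+n b)) (cong (flips a b +_) (flips-step b))

  flips-first : ∀ {a b} → a < b → count (changes a) ≤ flips a b
  flips-first {a} {b} a<b = begin
      count (changes a)                  ≡⟨ flips-step a ⟨
      flips a (suc a)                    ≤⟨ m≤m+n _ _ ⟩
      flips a (suc a) + flips (suc a) b  ≡⟨ flips-split (n≤1+n a) a<b ⟨
      flips a b                          ∎
    where open ≤-Reasoning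

  flips-parity : ∀ {a b} → a ≤ b → flips a b % 2 ≡ count (w a xor w b)
  flips-parity {a} a≤b = go (≤⇒≤′ a≤b)
    where
      open ≡-Reasoning
      go : ∀ {b} → a ≤′ b → flips a b % 2 ≡ count (w a xor w b)
      go ≤′-refl rewrite flips-refl a | xor-same (w a) = refl
      go (≤′-step {b} a≤′b) = begin
          flips a (suc b) % 2
        ≡⟨ cong (_% 2) (flips-snoc (≤′⇒≤ a≤′b)) ⟩
          (flips a b + count (changes b)) % 2
        ≡⟨ %-distribˡ-+ (flips a b) (count (changes b)) 2 ⟩
          (flips a b % 2 + count (changes b) % 2) % 2
        ≡⟨ cong (λ r → (r + count (changes b) % 2) % 2) (go a≤′b) ⟩
          (count (w a xor w b) + count (changes b) % 2) % 2
        ≡⟨ xor-parity (w a) (w b) (w (suc b)) ⟩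
          count (w a xor w (suc b))
        ∎

  flips-odd : ∀ {a b} → a ≤ b → w a ≡ true → w b ≡ false → flips a b % 2 ≡ 1
  flips-odd a≤b wa wb = trans (flips-parity a≤b) (cong₂ (λ x y → count (x xor y)) wa wb)

  flips-const : ∀ {a b c} → a ≤ b → (∀ p → a ≤ p → p ≤ b → w p ≡ c) → flips a b ≡ 0
  flips-const {a} {c = c} range = go (≤⇒≤′ range)
    where
      open ≡-Reasoning
      go : ∀ {b} → a ≤′ b → (∀ p → a ≤ p → p ≤ b → w p ≡ c) → flips a b ≡ 0
      go ≤′-refl _ = flips-refl a
      go (≤′-step {b} a≤′b) const = begin
          flips a (suc b)
        ≡⟨ flips-snoc a≤b ⟩
          flips a b + count (w b xor w (suc b))
        ≡⟨ cong₂ (λ x y → x + count y)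
             (go a≤′b (λ p l u → const p l (m≤n⇒m≤1+n u)))
             (cong₂ _xor_ (const b a≤b (n≤1+n b)) (const (suc b) (m≤n⇒m≤1+n a≤b) ≤-refl)) ⟩
          count (c xor c)
        ≡⟨ cong count (xor-same c) ⟩
          0
        ∎
        where
          a≤b : a ≤ b
          a≤b = ≤′⇒≤ a≤′b

  flips-leave : ∀ {a b c} → a < b → (∀ p → a ≤ p → p < b → w p ≡ c) →
    flips a b ≡ count (c xor w b)
  flips-leave {a} {suc b} {c} (s≤s a≤b) run = begin
      flips a (suc b)
    ≡⟨ flips-snoc a≤b ⟩
      flips a b + count (w b xor w (suc b))
    ≡⟨ cong₂ (λ x y → x + count (y xor w (suc b)))
         (flips-const a≤b (λ p l u → run p l (s≤s u))) (run b a≤b ≤-refl) ⟩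
      count (c xor w (suc b))
    ∎
    where open ≡-Reasoning

  flips-enter : ∀ {a b c} → a < b → (∀ p → a < p → p ≤ b → w p ≡ c) →
    flips a b ≡ count (w a xor c)
  flips-enter {a} {b} {c} a<b run = begin
      flips a b
    ≡⟨ flips-split (n≤1+n a) a<b ⟩
      flips a (suc a) + flips (suc a) b
    ≡⟨ cong₂ _+_ (flips-step a) (flips-const a<b run) ⟩
      count (changes a) + 0
    ≡⟨ +-identityʳ _ ⟩
      count (w a xor w (suc a))
    ≡⟨ cong (λ y → count (w a xor y)) (run (suc a) ≤-refl a<b) ⟩
      count (w a xor c)
    ∎
    where open ≡-Reasoning

  flips-run-≤1 : ∀ {a b c} → a ≤ b → (∀ p → a ≤ p → p < b → w p ≡ c) → flips a b ≤ 1
  flips-run-≤1 {a} a≤b run with m≤n⇒m<n∨m≡n a≤b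
  ... | inj₁ a<b  = ≤-trans (≤-reflexive (flips-leave a<b run)) (count≤1 _)
  ... | inj₂ refl = ≤-trans (≤-reflexive (flips-refl a)) z≤n

  flips-across-≤2 : ∀ {a b c} → a < b → (∀ p → a < p → p < b → w p ≡ c) → flips a b ≤ 2
  flips-across-≤2 {a} {b} a<b run = begin
      flips a b                          ≡⟨ flips-split (n≤1+n a) a<b ⟩
      flips a (suc a) + flips (suc a) b  ≤⟨ +-mono-≤ first (flips-run-≤1 a<b run) ⟩
      2                                  ∎
    where
      open ≤-Reasoning
      first : flips a (suc a) ≤ 1
      first = ≤-trans (≤-reflexive (flips-step a)) (count≤1 _)

  flips-across-zero : ∀ {a b c} → a < b → w a ≡ not c → (∀ p → a < p → p < b → w p ≡ c) →
    flips a b ≡ 0 → b ≡ suc a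
  flips-across-zero {a} {b} {c} a<b wa run none with m≤n⇒m<n∨m≡n a<b
  ... | inj₂ 1+a≡b  = sym 1+a≡b
  ... | inj₁ 1+a<b = contradiction (≤-trans one≤flips (≤-reflexive none)) 1+n≰n
    where
      first-is-change : count (changes a) ≡ 1
      first-is-change = cong count (trans (cong₂ _xor_ wa (run (suc a) ≤-refl 1+a<b)) (xor-not c))
      one≤flips : 1 ≤ flips a b
      one≤flips = ≤-trans (≤-reflexive (sym first-is-change)) (flips-first a<b)

Consecutive : ∀ {k} → Fin k → Fin k → Set
Consecutive i j = toℕ j ≡ suc (toℕ i)

consecutive⇒< : ∀ {k} {i j : Fin k} → Consecutive i j → i Fin.< j
consecutive⇒< j≡1+i = ≤-reflexive (sym j≡1+i)

consecutive⇒≤ : ∀ {k} {i j : Fin k} → Consecutive i j → i Fin.≤ j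
consecutive⇒≤ j≡1+i = <⇒≤ (consecutive⇒< j≡1+i)

consecutive⇒positive : ∀ {n} {i j : Fin (suc n)} → Consecutive i j → 0 < n
consecutive⇒positive {n} {j = j} j≡1+i =
  ≤-trans (s≤s z≤n) (subst (_≤ n) j≡1+i (s≤s⁻¹ (toℕ<n j)))

module Enumeration {n : ℕ} (f : Fin (suc n) → ℕ)
                   (increasing : ∀ i j → i Fin.< j → f i < f j) where

  reflects-< : ∀ i j → f i < f j → i Fin.< j
  reflects-< i j lt with <-cmp (toℕ i) (toℕ j)
  ... | tri< i<j _ _ = i<j
  ... | tri≈ _ i≡j _ = contradiction (cong f (toℕ-injective i≡j)) (<⇒≢ lt)
  ... | tri> _ _ j<i = contradiction (increasing j i j<i) (<-asym lt)

  injective : ∀ {i j} → f i ≡ f j → i ≡ j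
  injective {i} {j} eq with <-cmp (toℕ i) (toℕ j)
  ... | tri< i<j _ _ = contradiction eq (<⇒≢ (increasing i j i<j))
  ... | tri≈ _ i≡j _ = toℕ-injective i≡j
  ... | tri> _ _ j<i = contradiction (sym eq) (<⇒≢ (increasing j i j<i))

  monotone : ∀ i j → toℕ i ≤ toℕ j → f i ≤ f j
  monotone i j i≤j with m≤n⇒m<n∨m≡n i≤j
  ... | inj₁ i<j = <⇒≤ (increasing i j i<j)
  ... | inj₂ i≡j = ≤-reflexive (cong f (toℕ-injective i≡j))

  gap : ∀ i j k → Consecutive i j → f i < f k → f k < f j → ⊥
  gap i j k j≡1+i fi<fk fk<fj =
    <-irrefl refl (<-≤-trans (reflects-< i k fi<fk) (s≤s⁻¹ (subst (toℕ k <_) j≡1+i (reflects-< k j fk<fj))))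

  below-first : ∀ k → f k < f Fin.zero → ⊥
  below-first k lt = n≮0 (reflects-< k Fin.zero lt)

  above-last : ∀ k → f (fromℕ n) < f k → ⊥
  above-last k lt =
    <⇒≱ (subst (_< toℕ k) (toℕ-fromℕ n) (reflects-< (fromℕ n) k lt)) (s≤s⁻¹ (toℕ<n k))

injective⇒surjective : ∀ {k l} (f : Fin k → Fin l) → Injective _≡_ _≡_ f → l ≤ k →
  ∀ y → ∃ λ x → f x ≡ y
injective⇒surjective {l = suc l} f inj l<k y with any? (λ x → f x ≟ᶠ y)
... | yes hit  = hit
... | no  miss = contradiction (injective⇒≤ punched-injective) (<⇒≱ l<k)
  where
    avoids : ∀ x → y ≢ f x
    avoids x e = miss (x , sym e)
    punched-injective : Injective _≡_ _≡_ (λ x → Fin.punchOut (avoids x))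
    punched-injective e = inj (punchOut-injective (avoids _) (avoids _) e)

val-toℕ : ∀ {N} (σ : Permutation′ N) (p : Fin N) → val σ (toℕ p) ≡ toℕ (σ ⟨$⟩ʳ p)
val-toℕ {N} σ p with toℕ p <? N
... | yes p<N = cong (λ x → toℕ (σ ⟨$⟩ʳ x)) (fromℕ<-toℕ p p<N)
... | no  p≮N = contradiction (toℕ<n p) p≮N

prefix-interval : ∀ {N} (σ : Permutation′ (suc N)) → IsInvolution σ → (b : Fin (suc N)) →
  (∀ q → q Fin.≤ b → σ ⟨$⟩ʳ q Fin.≤ b) → IsInterval σ Fin.zero b
prefix-interval σ inv b closed _ j v _ _ _ j≤b _ v≤σj =
  σ ⟨$⟩ʳ v , z≤n , closed v (≤-trans v≤σj (closed j j≤b)) , inv v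

two-points : ∀ {N} {x y q : Fin N} → Consecutive x y → x Fin.≤ q → q Fin.≤ y → q ≡ x ⊎ q ≡ y
two-points y≡1+x x≤q q≤y with m≤n⇒m<n∨m≡n q≤y
... | inj₁ q<y = inj₁ (toℕ-injective (≤-antisym (s≤s⁻¹ (subst (_ <_) y≡1+x q<y)) x≤q))
... | inj₂ q≡y = inj₂ (toℕ-injective q≡y)

adjacent-image : ∀ {N} (σ : Permutation′ N) {x y : Fin N} → Consecutive x y →
  Consecutive (σ ⟨$⟩ʳ x) (σ ⟨$⟩ʳ y) →
  ∀ q → x Fin.≤ q → q Fin.≤ y → σ ⟨$⟩ʳ x Fin.≤ σ ⟨$⟩ʳ q × σ ⟨$⟩ʳ q Fin.≤ σ ⟨$⟩ʳ y
adjacent-image σ y≡1+x σy≡1+σx q x≤q q≤y with two-points y≡1+x x≤q q≤y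
... | inj₁ refl = ≤-refl , consecutive⇒≤ σy≡1+σx
... | inj₂ refl = consecutive⇒≤ σy≡1+σx , ≤-refl

adjacent-interval : ∀ {N} (σ : Permutation′ N) {x y : Fin N} → Consecutive x y →
  Consecutive (σ ⟨$⟩ʳ x) (σ ⟨$⟩ʳ y) → IsInterval σ x y
adjacent-interval σ y≡1+x σy≡1+σx i j v x≤i i≤y x≤j j≤y σi≤v v≤σj
  with two-points σy≡1+σx
         (≤-trans (proj₁ (adjacent-image σ y≡1+x σy≡1+σx i x≤i i≤y)) σi≤v)
         (≤-trans v≤σj (proj₂ (adjacent-image σ y≡1+x σy≡1+σx j x≤j j≤y)))
... | inj₁ refl = _ , ≤-refl , consecutive⇒≤ y≡1+x , refl
... | inj₂ refl = _ , consecutive⇒≤ y≡1+x , ≤-refl , refl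

module PairedInvolution
  (n : ℕ) (σ : Permutation′ (suc (suc (n + n))))
  (m M : Fin (suc n) → Fin (suc (suc (n + n))))
  (m<M : ∀ i → m i Fin.< M i)
  (m-increasing : ∀ i j → i Fin.< j → m i Fin.< m j)
  (M-increasing : ∀ i j → i Fin.< j → M i Fin.< M j)
  (σm : ∀ i → σ ⟨$⟩ʳ m i ≡ M i)
  (σM : ∀ i → σ ⟨$⟩ʳ M i ≡ m i) where

  N : ℕ
  N = suc (suc (n + n))

  mm MM : Fin (suc n) → ℕ
  mm k = toℕ (m k)
  MM k = toℕ (M k)

  module Lows  = Enumeration mm m-increasing
  module Highs = Enumeration MM M-increasing

  -- A small position is never a large one: m a = M b would give
  -- m b < M b = m a < M a = m b.
  m≢M : ∀ a b → m a ≢ M b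
  m≢M a b ma≡Mb = <-irrefl refl (<-trans (m<M b) (≤-<-trans (≤-reflexive (cong toℕ (sym ma≡Mb)))
    (<-≤-trans (m<M a) (≤-reflexive (cong toℕ Ma≡mb)))))
    where
      Ma≡mb : M a ≡ m b
      Ma≡mb = trans (sym (σm a)) (trans (cong (σ ⟨$⟩ʳ_) ma≡Mb) (σM b))

  pairs-injective : ∀ u v → [ m , M ]′ u ≡ [ m , M ]′ v → u ≡ v
  pairs-injective (inj₁ a) (inj₁ b) e = cong inj₁ (Lows.injective (cong toℕ e))
  pairs-injective (inj₁ a) (inj₂ b) e = contradiction e (m≢M a b)
  pairs-injective (inj₂ a) (inj₁ b) e = contradiction (sym e) (m≢M b a)
  pairs-injective (inj₂ a) (inj₂ b) e = cong inj₂ (Highs.injective (cong toℕ e))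

  -- The 2n+2 positions m_k, M_k are distinct, hence they are all positions.
  cover : ∀ p → (∃ λ k → m k ≡ p) ⊎ (∃ λ k → M k ≡ p)
  cover p with injective⇒surjective pairing pairing-injective enough p
    where
      pairing : Fin (suc n + suc n) → Fin N
      pairing x = [ m , M ]′ (splitAt (suc n) x)
      pairing-injective : Injective _≡_ _≡_ pairing
      pairing-injective {x} {y} e = trans (sym (join-splitAt (suc n) (suc n) x))
        (trans (cong (Fin.join (suc n) (suc n)) (pairs-injective (splitAt (suc n) x) (splitAt (suc n) y) e)) (join-splitAt (suc n) (suc n) y))
      enough : N ≤ suc n + suc n
      enough = ≤-reflexive (cong suc (sym (+-suc n n)))
  ... | x , e = decode (splitAt (suc n) x) e
    where
      decode : ∀ u → [ m , M ]′ u ≡ p → (∃ λ k → m k ≡ p) ⊎ (∃ λ k → M k ≡ p)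
      decode (inj₁ k) e = inj₁ (k , e)
      decode (inj₂ k) e = inj₂ (k , e)

  classify : ∀ p → p < N → (∃ λ k → mm k ≡ p) ⊎ (∃ λ k → MM k ≡ p)
  classify p p<N with cover (fromℕ< p<N)
  ... | inj₁ (k , e) = inj₁ (k , trans (cong toℕ e) (toℕ-fromℕ< p<N))
  ... | inj₂ (k , e) = inj₂ (k , trans (cong toℕ e) (toℕ-fromℕ< p<N))

  val-m : ∀ k → val σ (mm k) ≡ MM k
  val-m k = trans (val-toℕ σ (m k)) (cong toℕ (σm k))

  val-M : ∀ k → val σ (MM k) ≡ mm k
  val-M k = trans (val-toℕ σ (M k)) (cong toℕ (σM k))

  exceeds : ℕ → Bool
  exceeds j = j <ᵇ val σ j

  open Changes exceeds

  exceeds-m : ∀ k → exceeds (mm k) ≡ true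
  exceeds-m k rewrite val-m k = <ᵇ-true (m<M k)

  exceeds-M : ∀ k → exceeds (MM k) ≡ false
  exceeds-M k rewrite val-M k = <ᵇ-false (<⇒≤ (m<M k))

  -- σ has no fixed points: a position that is not an excedance is a deficiency.
  deficient : ∀ p → p < N → (val σ p <ᵇ p) ≡ not (exceeds p)
  deficient p p<N with classify p p<N
  ... | inj₁ (k , refl) = trans (cong (_<ᵇ mm k) (val-m k))
                            (trans (<ᵇ-false (<⇒≤ (m<M k))) (cong not (sym (exceeds-m k))))
  ... | inj₂ (k , refl) = trans (cong (_<ᵇ MM k) (val-M k))
                            (trans (<ᵇ-true (m<M k)) (cong not (sym (exceeds-M k))))

  crossesAt-changes : ∀ j → suc j < N → crossesAt σ j ≡ changes j
  crossesAt-changes j 1+j<N =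
    trans (cong₂ (λ d₁ d₀ → (exceeds j ∧ d₁) ∨ (d₀ ∧ exceeds (suc j)))
                 (deficient (suc j) 1+j<N) (deficient j (<-trans (n<1+n j) 1+j<N)))
          (sign-change (exceeds j) (exceeds (suc j)))

  crossings-flips : ∀ k → crossings σ (m k) (M k) ≡ flips (mm k) (MM k)
  crossings-flips k = countRange-cong (crossesAt σ) changes (mm k) (MM k ∸ mm k) λ j j<end →
    crossesAt-changes j (≤-<-trans (subst (suc j ≤_) (m+[n∸m]≡n (<⇒≤ (m<M k))) j<end) (toℕ<n (M k)))

  between-m : ∀ i j → Consecutive i j → ∀ p → mm i < p → p < mm j → exceeds p ≡ false
  between-m i j j≡1+i p l u with classify p (<-trans u (toℕ<n (m j)))
  ... | inj₁ (k , refl) = ⊥-elim (Lows.gap i j k j≡1+i l u)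
  ... | inj₂ (k , refl) = exceeds-M k

  between-M : ∀ i j → Consecutive i j → ∀ p → MM i < p → p < MM j → exceeds p ≡ true
  between-M i j j≡1+i p l u with classify p (<-trans u (toℕ<n (M j)))
  ... | inj₁ (k , refl) = exceeds-m k
  ... | inj₂ (k , refl) = ⊥-elim (Highs.gap i j k j≡1+i l u)

  before-first-M : ∀ p → p < MM Fin.zero → exceeds p ≡ true
  before-first-M p u with classify p (<-trans u (toℕ<n (M Fin.zero)))
  ... | inj₁ (k , refl) = exceeds-m k
  ... | inj₂ (k , refl) = ⊥-elim (Highs.below-first k u)

  after-last-m : ∀ p → mm (fromℕ n) < p → p < N → exceeds p ≡ false
  after-last-m p l p<N with classify p p<N
  ... | inj₁ (k , refl) = ⊥-elim (Lows.above-last k l)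
  ... | inj₂ (k , refl) = exceeds-M k

  s : Fin (suc n) → ℕ
  s k = crossings σ (m k) (M k)

  s-odd : ∀ k → s k % 2 ≡ 1
  s-odd k = trans (cong (_% 2) (crossings-flips k))
                  (flips-odd (<⇒≤ (m<M k)) (exceeds-m k) (exceeds-M k))

  s-first : s Fin.zero ≡ 1
  s-first = trans (crossings-flips Fin.zero)
    (trans (flips-leave (m<M Fin.zero) (λ p _ u → before-first-M p u))
           (cong (λ y → count (true xor y)) (exceeds-M Fin.zero)))

  s-last : s (fromℕ n) ≡ 1
  s-last = trans (crossings-flips (fromℕ n))
    (trans (flips-enter (m<M (fromℕ n)) (λ p l u → after-last-m p l (≤-<-trans u (toℕ<n (M (fromℕ n))))))
           (cong (λ y → count (y xor false)) (exceeds-m (fromℕ n))))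

  low-gap-≤2 : ∀ i j → Consecutive i j → flips (mm i) (mm j) ≤ 2
  low-gap-≤2 i j j≡1+i = flips-across-≤2 (m-increasing i j (consecutive⇒< j≡1+i)) (between-m i j j≡1+i)

  high-gap-≤2 : ∀ i j → Consecutive i j → flips (MM i) (MM j) ≤ 2
  high-gap-≤2 i j j≡1+i = flips-across-≤2 (M-increasing i j (consecutive⇒< j≡1+i)) (between-M i j j≡1+i)

  low-gap-zero : ∀ i j → Consecutive i j → flips (mm i) (mm j) ≡ 0 → mm j ≡ suc (mm i)
  low-gap-zero i j j≡1+i =
    flips-across-zero (m-increasing i j (consecutive⇒< j≡1+i)) (exceeds-m i) (between-m i j j≡1+i)

  high-gap-zero : ∀ i j → Consecutive i j → flips (MM i) (MM j) ≡ 0 → MM j ≡ suc (MM i)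
  high-gap-zero i j j≡1+i =
    flips-across-zero (M-increasing i j (consecutive⇒< j≡1+i)) (exceeds-M i) (between-M i j j≡1+i)

  -- If M_i < m_j for consecutive i, j, then σ maps the prefix [0, M_i] into itself:
  -- the small positions there are m_k with k ≤ i, and large ones map below themselves.
  prefix-closed : ∀ i j → Consecutive i j → MM i < mm j → ∀ q → q Fin.≤ M i → σ ⟨$⟩ʳ q Fin.≤ M i
  prefix-closed i j j≡1+i Mi<mj q q≤Mi with cover q
  ... | inj₁ (k , refl) = subst (Fin._≤ M i) (sym (σm k)) (Highs.monotone k i
          (s≤s⁻¹ (subst (toℕ k <_) j≡1+i (Lows.reflects-< k j (≤-<-trans q≤Mi Mi<mj)))))
  ... | inj₂ (k , refl) = subst (Fin._≤ M i) (sym (σM k)) (<⇒≤ (<-≤-trans (m<M k) q≤Mi))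

  module Simple (inv : IsInvolution σ) (simple : IsSimple σ) where

    -- The arcs of consecutive pairs overlap; otherwise [0, M_i] is a
    -- non-trivial interval.
    arcs-interleave : ∀ i j → Consecutive i j → mm j < MM i
    arcs-interleave i j j≡1+i with <-cmp (mm j) (MM i)
    ... | tri< mj<Mi _ _ = mj<Mi
    ... | tri≈ _ mj≡Mi _ = contradiction (toℕ-injective mj≡Mi) (m≢M j i)
    ... | tri> _ _ Mi<mj
      with simple Fin.zero (M i) z≤n (prefix-interval σ inv (M i) (prefix-closed i j j≡1+i Mi<mj))
    ...   | inj₁ 0≡Mi = contradiction (cong toℕ 0≡Mi) (<⇒≢ (≤-<-trans z≤n (m<M i)))
    ...   | inj₂ (_ , Mi-last) = contradiction Mi-last
            (<⇒≢ (≤-trans (s≤s (M-increasing i j (consecutive⇒< j≡1+i))) (toℕ<n (M j))))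

    -- The pairs of consecutive arcs are not both shifted by one; otherwise
    -- {m_i, m_j} is a non-trivial interval.
    not-parallel : ∀ i j → Consecutive i j → mm j ≡ suc (mm i) → MM j ≡ suc (MM i) → ⊥
    not-parallel i j j≡1+i mj≡1+mi Mj≡1+Mi
      with simple (m i) (m j) (consecutive⇒≤ mj≡1+mi) (adjacent-interval σ mj≡1+mi
             (trans (cong toℕ (σm j)) (trans Mj≡1+Mi (cong (λ x → suc (toℕ x)) (sym (σm i))))))
    ... | inj₁ mi≡mj = contradiction (cong toℕ mi≡mj) (<⇒≢ (consecutive⇒< mj≡1+mi))
    ... | inj₂ (mi≡0 , mj-last) = contradiction (sym (m+n≡0⇒m≡0 n n+n≡0)) (<⇒≢ (consecutive⇒positive j≡1+i))
      where
        n+n≡0 : n + n ≡ 0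
        n+n≡0 = suc-injective (suc-injective (trans (sym mj-last) (cong suc (trans mj≡1+mi (cong suc mi≡0)))))

    split-i : ∀ i j → Consecutive i j → s i ≡ flips (mm i) (mm j) + flips (mm j) (MM i)
    split-i i j j≡1+i = trans (crossings-flips i)
      (flips-split (<⇒≤ (m-increasing i j (consecutive⇒< j≡1+i))) (<⇒≤ (arcs-interleave i j j≡1+i)))

    split-j : ∀ i j → Consecutive i j → s j ≡ flips (mm j) (MM i) + flips (MM i) (MM j)
    split-j i j j≡1+i = trans (crossings-flips j)
      (flips-split (<⇒≤ (arcs-interleave i j j≡1+i)) (<⇒≤ (M-increasing i j (consecutive⇒< j≡1+i))))

    -- (iii) neighbouring arcs are not both crossed once: the middle count X is
    -- odd, so A = B = 0, and then the pairs would be parallel.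
    s-not-both-one : ∀ i j → Consecutive i j → s i ≡ 1 → s j ≡ 1 → ⊥
    s-not-both-one i j j≡1+i si≡1 sj≡1 =
      not-parallel i j j≡1+i (low-gap-zero i j j≡1+i low-zero) (high-gap-zero i j j≡1+i high-zero)
      where
        middle-odd : flips (mm j) (MM i) % 2 ≡ 1
        middle-odd = flips-odd (<⇒≤ (arcs-interleave i j j≡1+i)) (exceeds-m j) (exceeds-M i)
        low-zero : flips (mm i) (mm j) ≡ 0
        low-zero = odd-summand (flips (mm i) (mm j)) (flips (mm j) (MM i)) middle-odd (trans (sym (split-i i j j≡1+i)) si≡1)
        high-zero : flips (MM i) (MM j) ≡ 0
        high-zero = odd-summand (flips (MM i) (MM j)) (flips (mm j) (MM i)) middle-odd
          (trans (+-comm (flips (MM i) (MM j)) (flips (mm j) (MM i))) (trans (sym (split-j i j j≡1+i)) sj≡1))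

    -- (iv) neighbouring terms differ by at most 2, since A, B ≤ 2
    s-neighbours : ∀ i j → Consecutive i j → s j ≤ s i + 2 × s i ≤ s j + 2
    s-neighbours i j j≡1+i rewrite split-i i j j≡1+i | split-j i j j≡1+i =
      neighbour-sums _ (low-gap-≤2 i j j≡1+i) (high-gap-≤2 i j j≡1+i)

proposition7p1 : (n : ℕ) (σ : Permutation′ (suc (suc (n + n))))
    → IsInvolution σ → Avoids321 σ → IsSimple σ
    → (m M : Fin (suc n) → Fin (suc (suc (n + n))))
    → (∀ i → m i Fin.< M i)
    → (∀ i j → i Fin.< j → m i Fin.< m j)
    → (∀ i j → i Fin.< j → M i Fin.< M j)
    → (∀ i → σ ⟨$⟩ʳ m i ≡ M i)
    → (∀ i → σ ⟨$⟩ʳ M i ≡ m i)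
    → ((∀ i → crossings σ (m i) (M i) % 2 ≡ 1)
      × (crossings σ (m Fin.zero) (M Fin.zero) ≡ 1
         × crossings σ (m (fromℕ n)) (M (fromℕ n)) ≡ 1)
      × (∀ i j → crossings σ (m i) (M i) ≡ 1
           → (suc (toℕ i) ≡ toℕ j ⊎ suc (toℕ j) ≡ toℕ i)
           → crossings σ (m j) (M j) ≢ 1)
      × (∀ i j → toℕ j ≡ suc (toℕ i)
           → (crossings σ (m j) (M j) ≤ crossings σ (m i) (M i) + 2
              × crossings σ (m i) (M i) ≤ crossings σ (m j) (M j) + 2)))
proposition7p1 n σ inv _ simple m M m<M m-increasing M-increasing σm σM =
    s-odd
  , (s-first , s-last)
  , (λ i j si≡1 neighbours sj≡1 →
       [ (λ i+1≡j → s-not-both-one i j (sym i+1≡j) si≡1 sj≡1)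
       , (λ j+1≡i → s-not-both-one j i (sym j+1≡i) sj≡1 si≡1) ]′ neighbours)
  , s-neighbours
  where
    open PairedInvolution n σ m M m<M m-increasing M-increasing σm σM
    open Simple inv simple
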